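{- Let $\mathfrak{p}_n$ ($n \geq 1$) be defined as below. Then: (a) For every prime $p$ and every integer $n > p$ with $n \equiv -1 \pmod{p}$, we have $p \mid \mathfrak{p}_n$. In particular, every prime divides $\mathfrak{p}_n$ for infinitely many $n$. (b) For every prime $p$ and every $n \geq 1$ with $p \mid \mathfrak{p}_n$, we have $p \mid \mathfrak{p}_{n p^r + b}$ for all integers $r \geq 1$ and $0 \leq b < p^r$. (c) For every $n \geq 1$, $\operatorname{rad}^*(n+1) \mid \mathfrak{p}_n$. In particular, the number of distinct prime factors of $\mathfrak{p}_n$ is unbounded as $n$ varies.
   Context: For a prime $p$ and an integer $n \geq 0$, $s_p(n)$ denotes the sum of the digits of $n$ in base $p$. For $n \geq 1$ define $\mathfrak{p}_n := \prod_{p \text{ prime},\ s_p(n) \geq p} p$ (a finite product; the empty product is $1$). For $n \geq 1$, $\operatorname{rad}(n) := \prod_{p \mid n} p$, and $\operatorname{rad}^*(n) := 1$ if $n$ is prime, $\operatorname{rad}^*(n) := \operatorname{rad}(n)$ otherwise. -}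

module Defs where

open import Data.Nat using (ℕ; zero; suc; _+_; _*_; _≤_; _<_; _≤?_; _%_; _/_; NonZero)
open import Data.Nat.Divisibility using (_∣_; _∣?_)
open import Data.Nat.Primality using (Prime; prime?)
open import Data.List using (List; []; _∷_; upTo; filter; length)
open import Data.Nat.ListAction using (product)
open import Relation.Nullary using (¬_; yes; no)

-- Digit sum of n in base b, computed with `fuel` steps (one per digit).
-- For b ≥ 2 a fuel of n suffices, since n has at most n digits.
digitSumFuel : (fuel b n : ℕ) → ℕ
digitSumFuel zero    b n = 0
digitSumFuel (suc f) zero n = n
digitSumFuel (suc f) (suc k) zero = 0
digitSumFuel (suc f) (suc k) n@(suc _) = n % suc k + digitSumFuel f (suc k) (n / suc k)

-- s_b(n): sum of the base-b digits of n (meaningful for b ≥ 2).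
s : (b n : ℕ) → ℕ
s b n = digitSumFuel n b n

-- 𝔭_n = product of the primes p with s_p(n) ≥ p.
-- Any such p satisfies p ≤ s_p(n) ≤ n, so the range p < n + 1 contains them all.
frakP : ℕ → ℕ
frakP n = product (filter (λ p → prime? p) (filter (λ p → p ≤? s p n) (upTo (suc n))))

-- primes dividing n; all of them are ≤ n when n ≥ 1
primeDivisors : ℕ → List ℕ
primeDivisors n = filter (λ p → prime? p) (filter (λ p → p ∣? n) (upTo (suc n)))

rad : ℕ → ℕ
rad n = product (primeDivisors n)

radStar : ℕ → ℕ
radStar n with prime? n
... | yes _ = 1
... | no  _ = rad n

ω : ℕ → ℕ
ω n = length (primeDivisors n)

module Submission where

-- Everything rests on one criterion: a prime p divides 𝔭ₙ iff
-- s_p(n) ≥ p (`frakP-criterion`).  By unique factorisation a prime divides a product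
-- of primes filtered from a list iff it occurs there (`∣product-primesWith`), and the
-- range 0 … n used in the definition of 𝔭ₙ is harmless because s_p(n) ≤ n.
--
-- Two facts about base-b digit sums then give (a) and (b):
--   * if b < n and n ≡ -1 (mod b) then n = (b-1) + q·b with q ≥ 1, so s_b(n) ≥ b;
--   * appending r digits adds digit sums: s_b(n·bʳ + c) = s_b(n) + s_b(c) for c < bʳ.
-- For (c), a prime factor of a composite n + 1 is < n, so (a) puts it into 𝔭ₙ, and
-- rad(n+1), a product of such primes, divides 𝔭ₙ (sublists of primes have dividing
-- products).  Finally, for n = 3·q! − 1 every prime ≤ q divides 𝔭ₙ by (a), so
-- ω(𝔭ₙ) ≥ π(q), which is unbounded by Euclid's argument.

open import Defs
open import Algebra.Properties.CommutativeSemigroup using (x∙yz≈y∙xz)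
open import Data.List using (List; []; _∷_; _++_; [_]; filter; upTo; length)
open import Data.List.Properties using (filter-++; filter-accept; filter-reject; ++-identityʳ; length-++; upTo-∷ʳ)
open import Data.List.Membership.Propositional using (_∈_)
open import Data.List.Membership.Propositional.Properties using (∈-filter⁺; ∈-filter⁻; ∈-upTo⁺; ∈-upTo⁻)
open import Data.List.Relation.Unary.Any using (here; there)
open import Data.List.Relation.Unary.All using (_∷_)
open import Data.List.Relation.Unary.All.Properties using (all-filter)
open import Data.List.Relation.Binary.Sublist.Propositional using (_⊆_; []; _∷_; _∷ʳ_; ⊆-refl)
open import Data.List.Relation.Binary.Sublist.Propositional.Properties using (++⁺ʳ; filter⁺; filter-⊆)
open import Data.List.Relation.Binary.Sublist.Heterogeneous.Properties using (length-mono-≤)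
open import Data.Nat.Base using (ℕ; zero; suc; 2+; _+_; _*_; _^_; _/_; _%_; _!; pred; _≤_; _<_; z≤n; s≤s; NonZero; ≢-nonZero⁻¹)
open import Data.Nat.Properties
open import Data.Nat.DivMod
open import Data.Nat.Divisibility using (_∣_; _∣?_; divides; module ∣-Reasoning; ∣-refl; ∣-trans; 1∣_; ∣1⇒≡1; ∣⇒≤; m∣m*n; ∣n⇒∣m*n; *-monoʳ-∣; ∣m∣n⇒∣m+n; ∣m+n∣m⇒∣n; m≤n⇒m!∣n!)
open import Data.Nat.Induction using (<-rec)
open import Data.Nat.ListAction using (product)
open import Data.Nat.ListAction.Properties using (∈⇒∣product)
open import Data.Nat.Primality using (Prime; prime?; prime[2]; ¬prime[1]; productOfPrimes≢0)
open import Data.Nat.Primality.Factorisation using (factorise; factorisationHasAllPrimeFactors)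
open import Data.Nat.Solver using (module +-*-Solver)
open import Data.Product using (_×_; _,_; proj₁; proj₂; ∃-syntax)
open import Data.Sum using (inj₁; inj₂)
open import Function using (_∘_; _⇔_; mk⇔; Equivalence)
open import Level using (0ℓ)
open import Relation.Binary.PropositionalEquality hiding ([_])
open import Relation.Nullary using (¬_; yes; no; contradiction)
open import Relation.Unary using (Pred; Decidable)

open Equivalence using (to; from)

module DigitSum (k : ℕ) where

  b : ℕ
  b = 2+ k

  quotient< : ∀ m → suc m / b ≤ m
  quotient< m = ≤-pred (m/n<m (suc m) b (s≤s (s≤s z≤n)))

  digitSumFuel-0 : ∀ f → digitSumFuel f b 0 ≡ 0
  digitSumFuel-0 zero    = refl
  digitSumFuel-0 (suc f) = refl

  fuel-irrelevant : ∀ {f g} n → n ≤ f → n ≤ g →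
                    digitSumFuel f b n ≡ digitSumFuel g b n
  fuel-irrelevant {f} {g} zero _ _ = trans (digitSumFuel-0 f) (sym (digitSumFuel-0 g))
  fuel-irrelevant {suc f} {suc g} n@(suc m) (s≤s m≤f) (s≤s m≤g) =
    cong (n % b +_) (fuel-irrelevant (n / b) (≤-trans (quotient< m) m≤f)
                                            (≤-trans (quotient< m) m≤g))

  s-unfold : ∀ n → s b n ≡ n % b + s b (n / b)
  s-unfold zero    = refl
  s-unfold (suc m) = cong (suc m % b +_) (fuel-irrelevant (suc m / b) (quotient< m) ≤-refl)

  s-digit : ∀ {d} q → d < b → s b (d + q * b) ≡ d + s b q
  s-digit {d} q d<b = begin
    s b (d + q * b)                          ≡⟨ s-unfold (d + q * b) ⟩
    (d + q * b) % b + s b ((d + q * b) / b)  ≡⟨ cong₂ (λ x y → x + s b y) last-digit rest ⟩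
    d + s b q                                ∎
    where
    open ≡-Reasoning
    d%b≡d : d % b ≡ d
    d%b≡d = m<n⇒m%n≡m d<b
    last-digit : (d + q * b) % b ≡ d
    last-digit = trans ([m+kn]%n≡m%n d q b) d%b≡d
    no-carry : d % b + q * b % b < b
    no-carry = subst (_< b) (sym (trans (cong₂ _+_ d%b≡d (m*n%n≡0 q b)) (+-identityʳ d))) d<b
    rest : (d + q * b) / b ≡ q
    rest = begin
      (d + q * b) / b   ≡⟨ +-distrib-/ d (q * b) no-carry ⟩
      d / b + q * b / b ≡⟨ cong₂ _+_ (m<n⇒m/n≡0 d<b) (m*n/n≡m q b) ⟩
      q                 ∎

  s≡0⇒≡0 : ∀ n → s b n ≡ 0 → n ≡ 0
  s≡0⇒≡0 = <-rec _ step
    where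
    step : ∀ n → (∀ {m} → m < n → s b m ≡ 0 → m ≡ 0) → s b n ≡ 0 → n ≡ 0
    step zero      _   _   = refl
    step n@(suc m) rec s≡0 = begin
      n                 ≡⟨ m≡m%n+[m/n]*n n b ⟩
      n % b + n / b * b ≡⟨ cong₂ (λ x y → x + y * b) last≡0 (rec (s≤s (quotient< m)) rest≡0) ⟩
      0                 ∎
      where
      open ≡-Reasoning
      unfolded : n % b + s b (n / b) ≡ 0
      unfolded = trans (sym (s-unfold n)) s≡0
      last≡0 : n % b ≡ 0
      last≡0 = m+n≡0⇒m≡0 (n % b) unfolded
      rest≡0 : s b (n / b) ≡ 0
      rest≡0 = m+n≡0⇒n≡0 (n % b) unfolded

  s-positive : ∀ {n} → 0 < n → 0 < s b n
  s-positive {suc m} _ = n≢0⇒n>0 (λ s≡0 → 0≢1+n (sym (s≡0⇒≡0 (suc m) s≡0)))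

  -- A digit sum never exceeds the number, as the digit at position i weighs bⁱ ≥ 1.
  s≤ : ∀ n → s b n ≤ n
  s≤ = <-rec _ step
    where
    step : ∀ n → (∀ {m} → m < n → s b m ≤ m) → s b n ≤ n
    step zero      _   = z≤n
    step n@(suc m) rec = begin
      s b n               ≡⟨ s-unfold n ⟩
      n % b + s b (n / b) ≤⟨ +-monoʳ-≤ (n % b) (rec (s≤s (quotient< m))) ⟩
      n % b + n / b       ≤⟨ +-monoʳ-≤ (n % b) (m≤m*n (n / b) b) ⟩
      n % b + n / b * b   ≡⟨ m≡m%n+[m/n]*n n b ⟨
      n                   ∎
      where open ≤-Reasoning

  s-concat : ∀ r n {c} → c < b ^ r → s b (n * b ^ r + c) ≡ s b n + s b c
  s-concat zero n {zero} _ = begin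
    s b (n * 1 + 0) ≡⟨ cong (s b) (trans (+-identityʳ (n * 1)) (*-identityʳ n)) ⟩
    s b n           ≡⟨ +-identityʳ (s b n) ⟨
    s b n + 0       ∎
    where open ≡-Reasoning
  s-concat zero n {suc c} (s≤s ())
  s-concat (suc r) n {c} c<b^[1+r] = begin
    s b (n * b ^ suc r + c)                ≡⟨ cong (s b) split-last-digit ⟩
    s b (c % b + (n * b ^ r + c / b) * b)  ≡⟨ s-digit (n * b ^ r + c / b) (m%n<n c b) ⟩
    c % b + s b (n * b ^ r + c / b)        ≡⟨ cong (c % b +_) (s-concat r n c/b<b^r) ⟩
    c % b + (s b n + s b (c / b))          ≡⟨ x∙yz≈y∙xz +-commutativeSemigroup (c % b) (s b n) (s b (c / b)) ⟩
    s b n + (c % b + s b (c / b))          ≡⟨ cong (s b n +_) (s-unfold c) ⟨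
    s b n + s b c                          ∎
    where
    open ≡-Reasoning
    open +-*-Solver
    c/b<b^r : c / b < b ^ r
    c/b<b^r = m<n*o⇒m/o<n (subst (c <_) (*-comm b (b ^ r)) c<b^[1+r])
    split-last-digit : n * b ^ suc r + c ≡ c % b + (n * b ^ r + c / b) * b
    split-last-digit = trans (cong (n * b ^ suc r +_) (m≡m%n+[m/n]*n c b))
      (solve 5 (λ n B x y b′ → n :* (b′ :* B) :+ (x :+ y :* b′) := x :+ (n :* B :+ y) :* b′)
             refl n (b ^ r) (c % b) (c / b) b)

  -- If b < n and n ≡ -1 (mod b), then n = (b-1) + q·b with q ≥ 1, so s_b(n) ≥ b.
  base≤s : ∀ {n} → b < n → b ∣ suc n → b ≤ s b n
  base≤s b<n (divides 1 1+n≡b) =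
    contradiction (≤-reflexive (trans 1+n≡b (*-identityˡ b))) (<-asym b<n)
  base≤s {n} _ (divides (suc q@(suc _)) 1+n≡[1+q]b) = begin
    b                   ≡⟨ +-comm 1 (suc k) ⟩
    suc k + 1           ≤⟨ +-monoʳ-≤ (suc k) (s-positive {q} (s≤s z≤n)) ⟩
    suc k + s b q       ≡⟨ s-digit q ≤-refl ⟨
    s b (suc k + q * b) ≡⟨ cong (s b) (suc-injective 1+n≡[1+q]b) ⟨
    s b n               ∎
    where open ≤-Reasoning

-- The primes of xs satisfying Q, in order; 𝔭ₙ, rad n and ω n are all built from these.
primesWith : {Q : Pred ℕ 0ℓ} → Decidable Q → List ℕ → List ℕ
primesWith Q? xs = filter prime? (filter Q? xs)

-- By unique factorisation, a prime divides the product of `primesWith Q? xs`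
-- exactly when it is an element of xs satisfying Q.
∣product-primesWith : ∀ {Q : Pred ℕ 0ℓ} (Q? : Decidable Q) xs {p} → Prime p →
                      p ∣ product (primesWith Q? xs) ⇔ (p ∈ xs × Q p)
∣product-primesWith Q? xs pp = mk⇔
  (λ p∣ → ∈-filter⁻ Q? (proj₁ (∈-filter⁻ prime?
    (factorisationHasAllPrimeFactors pp p∣ (all-filter prime? (filter Q? xs))))))
  (λ (p∈xs , q) → ∈⇒∣product (∈-filter⁺ prime? (∈-filter⁺ Q? p∈xs q) pp))

primes-⊆ : ∀ {Q : Pred ℕ 0ℓ} (Q? : Decidable Q) {xs ys} →
           (∀ {x} → x ∈ xs → Prime x → Q x) → xs ⊆ ys →
           filter prime? xs ⊆ primesWith Q? ys
primes-⊆ Q? h [] = []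
primes-⊆ Q? h (y ∷ʳ σ) with Q? y
... | no _ = primes-⊆ Q? h σ
... | yes _ with prime? y
...   | no _  = primes-⊆ Q? h σ
...   | yes _ = y ∷ʳ primes-⊆ Q? h σ
primes-⊆ Q? h (_∷_ {x} refl σ) with Q? x
... | yes _ with prime? x
...   | no _  = primes-⊆ Q? (h ∘ there) σ
...   | yes _ = refl ∷ primes-⊆ Q? (h ∘ there) σ
primes-⊆ Q? h (_∷_ {x} refl σ) | no ¬q with prime? x
...   | no _   = primes-⊆ Q? (h ∘ there) σ
...   | yes px = contradiction (h (here refl) px) ¬q

⊆⇒product∣ : ∀ {xs ys} → xs ⊆ ys → product xs ∣ product ys
⊆⇒product∣ []               = ∣-refl
⊆⇒product∣ (y ∷ʳ σ)         = ∣n⇒∣m*n y (⊆⇒product∣ σ)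
⊆⇒product∣ (_∷_ {x} refl σ) = *-monoʳ-∣ x (⊆⇒product∣ σ)

upTo-⊆ : ∀ {m n} → m ≤ n → upTo m ⊆ upTo n
upTo-⊆ {n = zero} z≤n = []
upTo-⊆ {m} {suc n} m≤1+n with m≤n⇒m<n∨m≡n m≤1+n
... | inj₁ m<1+n = subst (upTo m ⊆_) (upTo-∷ʳ n) (++⁺ʳ [ n ] (upTo-⊆ (≤-pred m<1+n)))
... | inj₂ refl  = ⊆-refl

primesWith-++-nonPrime : ∀ {Q : Pred ℕ 0ℓ} (Q? : Decidable Q) xs {x} → ¬ Prime x →
                         primesWith Q? (xs ++ [ x ]) ≡ primesWith Q? xs
primesWith-++-nonPrime Q? xs {x} ¬px = begin
  filter prime? (filter Q? (xs ++ [ x ]))         ≡⟨ cong (filter prime?) (filter-++ Q? xs [ x ]) ⟩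
  filter prime? (filter Q? xs ++ filter Q? [ x ]) ≡⟨ filter-++ prime? (filter Q? xs) (filter Q? [ x ]) ⟩
  primesWith Q? xs ++ primesWith Q? [ x ]         ≡⟨ cong (primesWith Q? xs ++_) no-primes ⟩
  primesWith Q? xs ++ []                          ≡⟨ ++-identityʳ (primesWith Q? xs) ⟩
  primesWith Q? xs                                ∎
  where
  open ≡-Reasoning
  no-primes : primesWith Q? [ x ] ≡ []
  no-primes with Q? x
  ... | no _  = refl
  ... | yes _ = filter-reject prime? ¬px

-- The prime factors of 𝔭ₙ are exactly the primes p with s_p(n) ≥ p
-- (such p lie in the range 0 … n used by the definition, because s_p(n) ≤ n).
frakP-criterion : ∀ {p} n → Prime p → p ∣ frakP n ⇔ p ≤ s p n
frakP-criterion {2+ k} n pp = mk⇔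
  (proj₂ ∘ to ∣𝔭ₙ⇔)
  (λ p≤s → from ∣𝔭ₙ⇔ (∈-upTo⁺ (s≤s (≤-trans p≤s (DigitSum.s≤ k n))) , p≤s))
  where
  ∣𝔭ₙ⇔ : 2+ k ∣ frakP n ⇔ (2+ k ∈ upTo (suc n) × 2+ k ≤ s (2+ k) n)
  ∣𝔭ₙ⇔ = ∣product-primesWith (λ p → p ≤? s p n) (upTo (suc n)) pp

frakP≢0 : ∀ n → NonZero (frakP n)
frakP≢0 n = productOfPrimes≢0 (all-filter prime? (filter (λ p → p ≤? s p n) (upTo (suc n))))

part-a : (p n : ℕ) → Prime p → p < n → p ∣ suc n → p ∣ frakP n
part-a p@(2+ k) n pp p<n p∣1+n = from (frakP-criterion n pp) (DigitSum.base≤s k p<n p∣1+n)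

-- Hence every prime divides 𝔭ₙ for arbitrarily large n, e.g. n = (p-1) + (m+1)·p.
part-a-infinitely-often : (p : ℕ) → Prime p → (m : ℕ) → ∃[ n ] (m ≤ n × 1 ≤ n × p ∣ frakP n)
part-a-infinitely-often p@(2+ k) pp m =
  n , m≤n , s≤s z≤n , part-a p n pp p<n (divides (suc (suc m)) refl)
  where
  n : ℕ
  n = suc k + suc m * p
  m≤n : m ≤ n
  m≤n = ≤-trans (n≤1+n m) (≤-trans (m≤m*n (suc m) p) (m≤n+m (suc m * p) (suc k)))
  p<n : p < n
  p<n = begin-strict
    p             <⟨ m<m+n p {suc k} (s≤s z≤n) ⟩
    p + suc k     ≡⟨ +-comm p (suc k) ⟩
    suc k + p     ≤⟨ +-monoʳ-≤ (suc k) (m≤m+n p (m * p)) ⟩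
    n             ∎
    where open ≤-Reasoning

-- Part (b): appending r base-p digits b to n can only increase s_p,
-- since s_p(n·pʳ + b) = s_p(n) + s_p(b).
part-b : (p n : ℕ) → Prime p → 1 ≤ n → p ∣ frakP n →
         (r b : ℕ) → 1 ≤ r → b < p ^ r → p ∣ frakP (n * p ^ r + b)
part-b p@(2+ k) n pp _ p∣𝔭ₙ r b _ b<p^r = from (frakP-criterion (n * p ^ r + b) pp) (begin
  p                   ≤⟨ to (frakP-criterion n pp) p∣𝔭ₙ ⟩
  s p n               ≤⟨ m≤m+n (s p n) (s p b) ⟩
  s p n + s p b       ≡⟨ DigitSum.s-concat k r n b<p^r ⟨
  s p (n * p ^ r + b) ∎)
  where open ≤-Reasoning

-- Part (c), first half: a prime factor x of a composite n + 1 satisfies x < n,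
-- so it divides 𝔭ₙ by part (a); as rad(n+1) is the product of these distinct
-- primes, it divides 𝔭ₙ as well.
part-c-radical : (n : ℕ) → 1 ≤ n → radStar (suc n) ∣ frakP n
part-c-radical n _ with prime? (suc n)
... | yes _ = 1∣ frakP n
... | no ¬prime = begin
  rad (suc n)                                   ≡⟨ cong product drop-last ⟩
  product (primesWith divides? (upTo (suc n)))  ∣⟨ ⊆⇒product∣ (primes-⊆ criterion? factor-in-𝔭ₙ (filter-⊆ divides? (upTo (suc n)))) ⟩
  frakP n                                       ∎
  where
  open ∣-Reasoning
  divides? : Decidable (λ x → x ∣ suc n)
  divides? x = x ∣? suc n
  criterion? : Decidable (λ x → x ≤ s x n)
  criterion? x = x ≤? s x n
  drop-last : primesWith divides? (upTo (suc (suc n))) ≡ primesWith divides? (upTo (suc n))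
  drop-last = trans (cong (primesWith divides?) (sym (upTo-∷ʳ (suc n))))
                    (primesWith-++-nonPrime divides? (upTo (suc n)) ¬prime)
  factor-in-𝔭ₙ : ∀ {x} → x ∈ filter divides? (upTo (suc n)) → Prime x → x ≤ s x n
  factor-in-𝔭ₙ {x} x∈ px with ∈-filter⁻ divides? {xs = upTo (suc n)} x∈
  ... | x∈upTo , x∣1+n = to (frakP-criterion n px) (part-a x n px (≤∧≢⇒< (≤-pred (∈-upTo⁻ x∈upTo)) x≢n) x∣1+n)
    where
    -- n ∤ n + 1 unless n = 1, which is not prime.
    x≢n : x ≢ n
    x≢n refl = ¬prime[1] (subst Prime (∣1⇒≡1 (∣m+n∣m⇒∣n (subst (x ∣_) (+-comm 1 x) x∣1+n) ∣-refl)) px)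

prime⇒1≤ : ∀ {p} → Prime p → 1 ≤ p
prime⇒1≤ {suc _} _ = s≤s z≤n

∣-factorial : ∀ {x q} → 1 ≤ x → x ≤ q → x ∣ q !
∣-factorial {suc y} _ x≤q = ∣-trans (m∣m*n (y !)) (m≤n⇒m!∣n! x≤q)

-- Euclid: a prime factor of m! + 1 exceeds m.
prime-above : ∀ m → ∃[ q ] (Prime q × m < q)
prime-above m with factorise (suc (m !))
... | record { factors = [] ; isFactorisation = 1+m!≡1 } =
  contradiction (suc-injective 1+m!≡1) (≢-nonZero⁻¹ (m !) {{m !≢0}})
... | record { factors = q ∷ qs ; isFactorisation = 1+m!≡q·qs ; factorsPrime = pq ∷ _ } =
  q , pq , ≰⇒> q≰m
  where
  q∣1+m! : q ∣ 1 + m !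
  q∣1+m! = subst (q ∣_) (sym 1+m!≡q·qs) (m∣m*n (product qs))
  q≰m : ¬ q ≤ m
  q≰m q≤m = ¬prime[1] (subst Prime (∣1⇒≡1 (∣m+n∣m⇒∣n (subst (q ∣_) (+-comm 1 (m !)) q∣1+m!)
                                                     (∣-factorial (prime⇒1≤ pq) q≤m))) pq)

π : ℕ → ℕ
π m = length (filter prime? (upTo m))

π-suc-prime : ∀ {q} → Prime q → π (suc q) ≡ suc (π q)
π-suc-prime {q} pq = begin
  length (filter prime? (upTo (suc q)))                  ≡⟨ cong (length ∘ filter prime?) (upTo-∷ʳ q) ⟨
  length (filter prime? (upTo q ++ [ q ]))               ≡⟨ cong length (filter-++ prime? (upTo q) [ q ]) ⟩
  length (filter prime? (upTo q) ++ filter prime? [ q ]) ≡⟨ cong (λ ps → length (filter prime? (upTo q) ++ ps)) (filter-accept prime? pq) ⟩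
  length (filter prime? (upTo q) ++ [ q ])               ≡⟨ length-++ (filter prime? (upTo q)) ⟩
  π q + 1                                                ≡⟨ +-comm (π q) 1 ⟩
  suc (π q)                                              ∎
  where open ≡-Reasoning

many-primes : ∀ k → ∃[ q ] (Prime q × k ≤ π (suc q))
many-primes zero = 2 , prime[2] , z≤n
many-primes (suc k) with many-primes k
... | q , _ , k≤π[1+q] with prime-above q
...   | q′ , pq′ , q<q′ = q′ , pq′ , (begin
  suc k           ≤⟨ s≤s k≤π[1+q] ⟩
  suc (π (suc q)) ≤⟨ s≤s (length-mono-≤ (filter⁺ prime? prime? (λ { refl px → px }) (upTo-⊆ q<q′))) ⟩
  suc (π q′)      ≡⟨ π-suc-prime pq′ ⟨
  π (suc q′)      ∎)
  where open ≤-Reasoning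

-- n = 3·q! − 1 exceeds every x ≤ q, and each positive x ≤ q divides n + 1 = 3·q!.
factorial-witness : ∀ q → ∃[ n ] (1 ≤ n × (∀ {x} → 1 ≤ x → x ≤ q → x < n × x ∣ suc n))
factorial-witness q = n , ≤-trans 1≤F F≤n , λ 1≤x x≤q → x<n 1≤x x≤q , x∣1+n 1≤x x≤q
  where
  F n : ℕ
  F = q !
  n = pred F + (F + F)
  instance _ = q !≢0
  1≤F : 1 ≤ F
  1≤F = 1≤n! q
  F≤n : F ≤ n
  F≤n = ≤-trans (m≤m+n F F) (m≤n+m (F + F) (pred F))
  x<n : ∀ {x} → 1 ≤ x → x ≤ q → x < n
  x<n {x} 1≤x x≤q = begin-strict
    x         ≤⟨ ∣⇒≤ (∣-factorial 1≤x x≤q) ⟩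
    F         <⟨ m<m+n F 1≤F ⟩
    F + F     ≤⟨ m≤n+m (F + F) (pred F) ⟩
    n         ∎
    where open ≤-Reasoning
  x∣1+n : ∀ {x} → 1 ≤ x → x ≤ q → x ∣ suc n
  x∣1+n {x} 1≤x x≤q = subst (x ∣_) (cong (_+ (F + F)) (sym (suc-pred F)))
                            (∣m∣n⇒∣m+n x∣F (∣m∣n⇒∣m+n x∣F x∣F))
    where
    x∣F : x ∣ F
    x∣F = ∣-factorial 1≤x x≤q

-- Part (c), second half: for n = 3·q! − 1 every prime ≤ q divides 𝔭ₙ by part (a),
-- so ω(𝔭ₙ) ≥ π(q + 1), which is unbounded.
part-c-unbounded : (k : ℕ) → ∃[ n ] (1 ≤ n × k ≤ ω (frakP n))
part-c-unbounded k with many-primes k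
... | q , pq , k≤π[1+q] with factorial-witness q
...   | n , 1≤n , witness = n , 1≤n , (begin
  k                                          ≤⟨ k≤π[1+q] ⟩
  length (filter prime? (upTo (suc q)))      ≤⟨ length-mono-≤ (primes-⊆ (_∣? frakP n) prime∣𝔭ₙ (upTo-⊆ (s≤s q≤𝔭ₙ))) ⟩
  length (primesWith (_∣? frakP n) (upTo (suc (frakP n)))) ∎)
  where
  open ≤-Reasoning
  prime∣𝔭ₙ : ∀ {x} → x ∈ upTo (suc q) → Prime x → x ∣ frakP n
  prime∣𝔭ₙ {x} x∈ px = part-a x n px (proj₁ (witness 1≤x x≤q)) (proj₂ (witness 1≤x x≤q))
    where
    x≤q : x ≤ q
    x≤q = ≤-pred (∈-upTo⁻ x∈)
    1≤x : 1 ≤ x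
    1≤x = prime⇒1≤ px
  q≤𝔭ₙ : q ≤ frakP n
  q≤𝔭ₙ = ∣⇒≤ {{frakP≢0 n}} (prime∣𝔭ₙ (∈-upTo⁺ ≤-refl) pq)

theorem1 :
    -- (a)
    ((p n : ℕ) → Prime p → p < n → p ∣ suc n → p ∣ frakP n)
    × ((p : ℕ) → Prime p → (m : ℕ) → ∃[ n ] (m ≤ n × 1 ≤ n × p ∣ frakP n))
    -- (b)
    × ((p n : ℕ) → Prime p → 1 ≤ n → p ∣ frakP n →
         (r b : ℕ) → 1 ≤ r → b < p ^ r → p ∣ frakP (n * p ^ r + b))
    -- (c)
    × ((n : ℕ) → 1 ≤ n → radStar (suc n) ∣ frakP n)
    × ((k : ℕ) → ∃[ n ] (1 ≤ n × k ≤ ω (frakP n)))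
theorem1 = part-a , part-a-infinitely-often , part-b , part-c-radical , part-c-unbounded
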